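{- Let $P$ be a non-identity $n\times n$ permutation matrix which is settled and Strang canonical, and let $w\ge1$ be its bandwidth. Then $P$ can be written as a product of fewer than $2w$ permutation matrices each of bandwidth at most $1$.
   Context: For an $n\times n$ permutation matrix $Q$, let $c_i(Q)$ be the column index of the $1$ in row $i$. The bandwidth of $Q$ is $\max_i|c_i(Q)-i|$; a matrix $M=(m_{ij})$ has bandwidth at most $1$ if $m_{ij}=0$ whenever $|i-j|>1$. Rows $i<j$ form an inverted pair if $c_i(Q)>c_j(Q)$, otherwise a contented pair. Row $i$ is positive if $c_i(Q)>i$, negative if $c_i(Q)<i$, neutral if $c_i(Q)=i$. Column $j$ is positive (negative, neutral) if the $1$ in column $j$ lies above (below, on) the diagonal. Sections: take the finest partition of $\{1,\dots,n\}$ into consecutive intervals each mapped onto itself by $i\mapsto c_i(Q)$; the corresponding diagonal blocks are the sections of $Q$. A section is upper-canonical if its positive rows are pairwise contented, lower-canonical if its negative rows are pairwise contented; $Q$ is Strang canonical if every section is both. A section is row-settled if all its positive rows lie above all its negative rows, and column-settled if all its negative columns lie to the left of all its positive columns. $Q$ is settled if either all its sections are row-settled or all its sections are column-settled. -}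

module Defs where

open import Data.Nat using (ℕ; _≤_; _<_; ∣_-_∣)
open import Data.Fin using (Fin; toℕ)
open import Data.Fin.Permutation using (Permutation′; _⟨$⟩ʳ_; _⟨$⟩ˡ_)
open import Data.List using (List; []; _∷_)
open import Data.List.Relation.Unary.All using (All)
open import Data.Product using (Σ; _×_; ∃)
open import Data.Sum using (_⊎_)
open import Relation.Nullary using (¬_)
open import Relation.Binary.PropositionalEquality using (_≡_)
open import Function.Bundles using (_⇔_)

-- A permutation matrix Q is represented by its permutation π, with
-- c_i(Q) = π ⟨$⟩ʳ i  (column of the 1 in row i).  Indices are 0-based.

module _ {n : ℕ} (P : Permutation′ n) where

  c : Fin n → Fin n
  c i = P ⟨$⟩ʳ i

  r : Fin n → Fin n
  r j = P ⟨$⟩ˡ j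

  IsIdentity : Set
  IsIdentity = ∀ i → c i ≡ i

  BandwidthAtMost : ℕ → Set
  BandwidthAtMost w = ∀ i → ∣ toℕ (c i) - toℕ i ∣ ≤ w

  HasBandwidth : ℕ → Set
  HasBandwidth w = BandwidthAtMost w × ∃ λ i → ∣ toℕ (c i) - toℕ i ∣ ≡ w

  -- The sections are the blocks of the partition determined by all cut points
  -- (the finest partition into consecutive intervals each mapped onto itself).
  Cut : ℕ → Set
  Cut k = ∀ i → toℕ i < k → toℕ (c i) < k

  SameSection : Fin n → Fin n → Set
  SameSection i j = ∀ k → Cut k → ((k ≤ toℕ i) ⇔ (k ≤ toℕ j))

  PositiveRow NegativeRow : Fin n → Set
  PositiveRow i = toℕ i < toℕ (c i)
  NegativeRow i = toℕ (c i) < toℕ i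

  PositiveCol NegativeCol : Fin n → Set
  PositiveCol j = toℕ (r j) < toℕ j
  NegativeCol j = toℕ j < toℕ (r j)

  Contented : Fin n → Fin n → Set
  Contented i j = toℕ (c i) < toℕ (c j)

  StrangCanonical : Set
  StrangCanonical =
    (∀ i j → SameSection i j → toℕ i < toℕ j →
       PositiveRow i → PositiveRow j → Contented i j)
    × (∀ i j → SameSection i j → toℕ i < toℕ j →
       NegativeRow i → NegativeRow j → Contented i j)

  AllRowSettled : Set
  AllRowSettled = ∀ i j → SameSection i j →
    PositiveRow i → NegativeRow j → toℕ i < toℕ j

  -- every section is column-settled (sections are the same index blocks
  -- for rows and columns, since they are diagonal blocks)
  AllColumnSettled : Set
  AllColumnSettled = ∀ j j′ → SameSection j j′ →
    NegativeCol j → PositiveCol j′ → toℕ j < toℕ j′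

  Settled : Set
  Settled = AllRowSettled ⊎ AllColumnSettled

-- Column map of the matrix product Q₁ Q₂ ⋯ Q_k of permutation matrices:
-- row i of the product has its 1 in column c_{Q_k}(⋯ c_{Q₁}(i) ⋯).
-- The empty product is the identity matrix.
productCol : ∀ {n} → List (Permutation′ n) → Fin n → Fin n
productCol []       i = i
productCol (Q ∷ Qs) i = productCol Qs (c Q i)

IsProductOf : ∀ {n} → Permutation′ n → List (Permutation′ n) → Set
IsProductOf P Qs = ∀ i → c P i ≡ productCol Qs i

AllBandwidth≤1 : ∀ {n} → List (Permutation′ n) → Set
AllBandwidth≤1 = All (λ Q → BandwidthAtMost Q 1)

-- By the 0–1 principle it suffices to follow, for each threshold k, the number
-- ones A k p of entries ≥ k among the first p positions.  For p in the section of k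
-- it is at most max(⌊(p + α − k − t)/2⌋, p − k) after t rounds, where α is D + w
-- rounded up to the parity of k + s + w (D entries ≥ k initially precede k and the
-- section starts at s): an active comparator at p inherits the bounds at p − 1 and
-- p + 1, and one is idle only in rounds where the bound does not decrease.  D ≤ w, and
-- D = w forces s = k − w, whose parity makes the rounding vanish; so α ≤ 2w and after
-- 2w − 1 rounds no entry ≥ k precedes position k.

module Submission where

open import Defs
open import Data.Nat
open import Data.Nat.Properties
open import Data.Nat.Induction using (<-rec)
open import Data.Nat.Tactic.RingSolver using (solve-∀)
open import Data.Parity.Base using (Parity; 0ℙ; 1ℙ; _⁻¹) renaming (_+_ to _+ℙ_)
import Data.Parity.Properties as Parity
open import Data.Fin using (Fin; toℕ; fromℕ<; fromℕ; inject₁)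
open import Data.Fin.Properties
  using (toℕ<n; toℕ-fromℕ<; toℕ-injective; fromℕ<-toℕ; toℕ-fromℕ; toℕ-inject₁)
open import Data.Fin.Permutation using (Permutation′; _⟨$⟩ˡ_; permutation; inverseˡ)
open import Data.List using (List; []; _∷_; _++_; length)
open import Data.List.Properties using (length-++)
open import Data.List.Relation.Unary.All using ([]; _∷_)
open import Data.List.Relation.Unary.All.Properties using (++⁺)
open import Data.Product using (Σ; _×_; _,_; proj₁; proj₂)
open import Data.Sum using (inj₁; inj₂)
open import Data.Empty using (⊥-elim)
open import Function using (_∘_)
open import Relation.Nullary using (¬_; Dec; yes; no)
open import Relation.Nullary.Decidable using (_×-dec_; ¬?; decidable-stable)
open import Relation.Unary using (Decidable)
open import Relation.Binary.Definitions using (tri<; tri≈; tri>)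
open import Relation.Binary.PropositionalEquality
open import Algebra.Properties.CommutativeMonoid.Sum +-0-commutativeMonoid
  using (sum; sum-permute; sum-cong-≗; sum-init-last)
open import Algebra.Properties.CommutativeSemigroup +-commutativeSemigroup using (interchange; xy∙z≈xz∙y)

parity-+-double : ∀ m n → parity (m + (n + n)) ≡ parity m
parity-+-double m n = begin
  parity (m + (n + n))                ≡⟨ Parity.+-homo-+ m (n + n) ⟩
  parity m +ℙ parity (n + n)          ≡⟨ cong (parity m +ℙ_) (Parity.+-homo-+ n n) ⟩
  parity m +ℙ (parity n +ℙ parity n)  ≡⟨ cong (parity m +ℙ_) (Parity.p+p≡0ℙ (parity n)) ⟩
  parity m +ℙ 0ℙ                      ≡⟨ Parity.+-identityʳ (parity m) ⟩
  parity m                            ∎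
  where open ≡-Reasoning

parity-∸ : ∀ {m n} → n ≤ m → parity (m ∸ n) ≡ parity (m + n)
parity-∸ {m} {n} n≤m = begin
  parity (m ∸ n)             ≡⟨ sym (parity-+-double (m ∸ n) n) ⟩
  parity (m ∸ n + (n + n))   ≡⟨ cong parity (sym (+-assoc (m ∸ n) n n)) ⟩
  parity (m ∸ n + n + n)     ≡⟨ cong (λ x → parity (x + n)) (m∸n+n≡m n≤m) ⟩
  parity (m + n)             ∎
  where open ≡-Reasoning

parity-suc : ∀ n {p} → parity (suc n) ≡ p → parity n ≡ p ⁻¹
parity-suc n eq = trans (sym (Parity.suc-homo-⁻¹ n)) (cong _⁻¹ eq)

bit : Parity → ℕ
bit 0ℙ = 0
bit 1ℙ = 1

parity-bit : ∀ p → parity (bit p) ≡ p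
parity-bit 0ℙ = refl
parity-bit 1ℙ = refl

bit≤1 : ∀ p → bit p ≤ 1
bit≤1 0ℙ = z≤n
bit≤1 1ℙ = ≤-refl

⌊suc/2⌋-even : ∀ n → parity n ≡ 0ℙ → ⌊ suc n /2⌋ ≡ ⌊ n /2⌋
⌊suc/2⌋-even zero          _    = refl
⌊suc/2⌋-even (suc zero)    ()
⌊suc/2⌋-even (suc (suc n)) even = cong suc (⌊suc/2⌋-even n even)

⌊/2⌋-pred-odd : ∀ n → parity n ≡ 1ℙ → ⌊ n /2⌋ ≡ ⌊ pred n /2⌋
⌊/2⌋-pred-odd (suc n) odd = ⌊suc/2⌋-even n (parity-suc n odd)

⌊∸/2⌋-odd : ∀ m n → parity (m + n) ≡ 1ℙ → ⌊ (m ∸ n) /2⌋ ≤ ⌊ (m ∸ suc n) /2⌋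
⌊∸/2⌋-odd m n odd with n ≤? m
... | no n≰m = ≤-trans (≤-reflexive (cong ⌊_/2⌋ (m≤n⇒m∸n≡0 (<⇒≤ (≰⇒> n≰m))))) z≤n
... | yes n≤m = ≤-reflexive (trans (⌊/2⌋-pred-odd (m ∸ n) (trans (parity-∸ n≤m) odd))
                                   (cong ⌊_/2⌋ (pred[m∸n]≡m∸[1+n] m n)))

⌊/2⌋∸1 : ∀ n → ⌊ n /2⌋ ∸ 1 ≡ ⌊ (n ∸ 2) /2⌋
⌊/2⌋∸1 zero          = refl
⌊/2⌋∸1 (suc zero)    = refl
⌊/2⌋∸1 (suc (suc n)) = refl

⌊suc∸/2⌋∸1 : ∀ m n → ⌊ (suc m ∸ n) /2⌋ ∸ 1 ≡ ⌊ (m ∸ suc n) /2⌋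
⌊suc∸/2⌋∸1 m n = trans (⌊/2⌋∸1 (suc m ∸ n))
  (cong ⌊_/2⌋ (trans (∸-+-assoc (suc m) n 2) (cong (suc m ∸_) (+-comm n 2))))

≤⌊+/2⌋ : ∀ {x a b} → x ≤ a → x ≤ b → x ≤ ⌊ (a + b) /2⌋
≤⌊+/2⌋ {x} x≤a x≤b = ≤-trans (≤-reflexive (n≡⌊n+n/2⌋ x)) (⌊n/2⌋-mono (+-mono-≤ x≤a x≤b))

m∸[n∸o]≤m+o∸n : ∀ m n o → m ∸ (n ∸ o) ≤ m + o ∸ n
m∸[n∸o]≤m+o∸n m n       zero    = ≤-reflexive (cong (_∸ n) (sym (+-identityʳ m)))
m∸[n∸o]≤m+o∸n m zero    (suc o) = m≤m+n m (suc o)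
m∸[n∸o]≤m+o∸n m (suc n) (suc o) =
  ≤-trans (m∸[n∸o]≤m+o∸n m n o) (≤-reflexive (cong (_∸ suc n) (sym (+-suc m o))))

∣1+n-n∣≡1 : ∀ n → ∣ suc n - n ∣ ≡ 1
∣1+n-n∣≡1 zero    = refl
∣1+n-n∣≡1 (suc n) = ∣1+n-n∣≡1 n

𝟙 : ∀ {a} {A : Set a} → Dec A → ℕ
𝟙 (yes _) = 1
𝟙 (no _)  = 0

𝟙≤1 : ∀ {a} {A : Set a} (d : Dec A) → 𝟙 d ≤ 1
𝟙≤1 (yes _) = ≤-refl
𝟙≤1 (no _)  = z≤n

𝟙-no : ∀ {a} {A : Set a} (d : Dec A) → ¬ A → 𝟙 d ≡ 0
𝟙-no (yes a) ¬a = ⊥-elim (¬a a)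
𝟙-no (no _)  _  = refl

count : {Q : ℕ → Set} → Decidable Q → ℕ → ℕ
count Q? zero    = 0
count Q? (suc p) = count Q? p + 𝟙 (Q? p)

module _ {Q : ℕ → Set} (Q? : Decidable Q) where

  count-≤ : ∀ p → count Q? p ≤ p
  count-≤ zero    = z≤n
  count-≤ (suc p) = ≤-trans (+-mono-≤ (count-≤ p) (𝟙≤1 (Q? p))) (≤-reflexive (+-comm p 1))

  count-mono : ∀ {p q} → p ≤ q → count Q? p ≤ count Q? q
  count-mono {q = zero}  z≤n = ≤-refl
  count-mono {q = suc q} p≤1+q with m≤n⇒m<n∨m≡n p≤1+q
  ... | inj₂ refl       = ≤-refl
  ... | inj₁ (s≤s p≤q)  = ≤-trans (count-mono p≤q) (m≤m+n _ _)

  count-≤-+∸ : ∀ p q → count Q? q ≤ count Q? p + (q ∸ p)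
  count-≤-+∸ p zero    = z≤n
  count-≤-+∸ p (suc q) with p ≤? q
  ... | no p≰q  = ≤-trans (count-mono (≰⇒> p≰q)) (m≤m+n _ _)
  ... | yes p≤q = begin
    count Q? q + 𝟙 (Q? q)          ≤⟨ +-mono-≤ (count-≤-+∸ p q) (𝟙≤1 (Q? q)) ⟩
    count Q? p + (q ∸ p) + 1       ≡⟨ +-assoc (count Q? p) (q ∸ p) 1 ⟩
    count Q? p + (q ∸ p + 1)       ≡⟨ cong (count Q? p +_) (+-comm (q ∸ p) 1) ⟩
    count Q? p + suc (q ∸ p)       ≡⟨ cong (count Q? p +_) (sym (+-∸-assoc 1 p≤q)) ⟩
    count Q? p + (suc q ∸ p)       ∎
    where open ≤-Reasoning

  count-split : ∀ p d → count Q? (p + d) ≡ count Q? p + count (λ j → Q? (p + j)) d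
  count-split p zero    = trans (cong (count Q?) (+-identityʳ p)) (sym (+-identityʳ _))
  count-split p (suc d) rewrite +-suc p d | count-split p d =
    +-assoc (count Q? p) (count (λ j → Q? (p + j)) d) (𝟙 (Q? (p + d)))

  count-skip : ∀ {p} → ¬ Q p → count Q? (suc p) ≡ count Q? p
  count-skip {p} ¬Qp = trans (cong (count Q? p +_) (𝟙-no (Q? p) ¬Qp)) (+-identityʳ _)

  count-none-below : ∀ {m} → (∀ {i} → i < m → ¬ Q i) → ∀ p → count Q? p ≤ p ∸ m
  count-none-below none zero = z≤n
  count-none-below {m} none (suc p) with m ≤? p
  ... | no m≰p  = ≤-trans (≤-reflexive (count-skip (none (≰⇒> m≰p))))
                          (≤-trans (count-none-below none p) (∸-monoˡ-≤ m (n≤1+n p)))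
  ... | yes m≤p = ≤-trans (+-mono-≤ (count-none-below none p) (𝟙≤1 (Q? p)))
                          (≤-reflexive (trans (+-comm (p ∸ m) 1) (sym (+-∸-assoc 1 m≤p))))

  count-none-above : ∀ {m} → (∀ {i} → Q i → i < m) → ∀ p → count Q? p ≤ count Q? m
  count-none-above none zero = z≤n
  count-none-above {m} none (suc p) with suc p ≤? m
  ... | yes 1+p≤m = count-mono 1+p≤m
  ... | no  1+p≰m = ≤-trans (≤-reflexive (count-skip (1+p≰m ∘ none))) (count-none-above none p)

  count≡0⇒¬ : ∀ {p i} → count Q? p ≡ 0 → i < p → ¬ Q i
  count≡0⇒¬ {p} {i} count≡0 i<p Qi = 1+n≰n (begin
    1                            ≡⟨ sym (𝟙-yes (Q? i)) ⟩
    𝟙 (Q? i)                     ≤⟨ m≤n+m _ (count Q? i) ⟩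
    count Q? (suc i)             ≤⟨ count-mono i<p ⟩
    count Q? p                   ≡⟨ count≡0 ⟩
    0                            ∎)
    where
    open ≤-Reasoning
    𝟙-yes : (d : Dec (Q i)) → 𝟙 d ≡ 1
    𝟙-yes (yes _) = refl
    𝟙-yes (no ¬Qi) = ⊥-elim (¬Qi Qi)

module _ {Q R : ℕ → Set} (Q? : Decidable Q) (R? : Decidable R) where

  count-⊆ : ∀ {p} → (∀ {i} → i < p → Q i → R i) → count Q? p ≤ count R? p
  count-⊆ {zero}  Q⊆R = z≤n
  count-⊆ {suc p} Q⊆R = +-mono-≤ (count-⊆ (Q⊆R ∘ m<n⇒m<1+n)) (𝟙-⊆ (Q? p) (R? p))
    where
    𝟙-⊆ : (x : Dec (Q p)) (y : Dec (R p)) → 𝟙 x ≤ 𝟙 y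
    𝟙-⊆ (yes Qp) (yes _)  = ≤-refl
    𝟙-⊆ (yes Qp) (no ¬Rp) = ⊥-elim (¬Rp (Q⊆R ≤-refl Qp))
    𝟙-⊆ (no _)   _        = z≤n

  count-partition : (∀ {i} → Q i → ¬ R i) → (∀ {i} → ¬ Q i → R i) →
                    ∀ p → count Q? p + count R? p ≡ p
  count-partition disjoint cover zero    = refl
  count-partition disjoint cover (suc p) = begin
    count Q? p + 𝟙 (Q? p) + (count R? p + 𝟙 (R? p))  ≡⟨ interchange (count Q? p) _ _ _ ⟩
    count Q? p + count R? p + (𝟙 (Q? p) + 𝟙 (R? p))  ≡⟨ cong₂ _+_ (count-partition disjoint cover p)
                                                                     (exactly-one (Q? p) (R? p)) ⟩
    p + 1                                             ≡⟨ +-comm p 1 ⟩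
    suc p                                             ∎
    where
    open ≡-Reasoning
    exactly-one : (x : Dec (Q p)) (y : Dec (R p)) → 𝟙 x + 𝟙 y ≡ 1
    exactly-one (yes Qp) (yes Rp) = ⊥-elim (disjoint Qp Rp)
    exactly-one (yes _)  (no _)   = refl
    exactly-one (no _)   (yes _)  = refl
    exactly-one (no ¬Qp) (no ¬Rp) = ⊥-elim (¬Rp (cover ¬Qp))

count-<? : ∀ m p → count (_<? m) p ≡ p ⊓ m
count-<? m zero    = refl
count-<? m (suc p) with p <? m
... | yes p<m = begin
  count (_<? m) p + 1   ≡⟨ cong (_+ 1) (trans (count-<? m p) (m≤n⇒m⊓n≡m (<⇒≤ p<m))) ⟩
  p + 1                 ≡⟨ +-comm p 1 ⟩
  suc p                 ≡⟨ sym (m≤n⇒m⊓n≡m p<m) ⟩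
  suc p ⊓ m             ∎
  where open ≡-Reasoning
... | no  p≮m = begin
  count (_<? m) p + 0   ≡⟨ +-identityʳ _ ⟩
  count (_<? m) p       ≡⟨ count-<? m p ⟩
  p ⊓ m                 ≡⟨ m≥n⇒m⊓n≡n (≮⇒≥ p≮m) ⟩
  m                     ≡⟨ sym (m≥n⇒m⊓n≡n (m≤n⇒m≤1+n (≮⇒≥ p≮m))) ⟩
  suc p ⊓ m             ∎
  where open ≡-Reasoning

count≡p⇒ : ∀ {Q : ℕ → Set} (Q? : Decidable Q) {p i} → count Q? p ≡ p → i < p → Q i
count≡p⇒ {Q} Q? {p} full i<p = decidable-stable (Q? _) (count≡0⇒¬ (¬? ∘ Q?) none i<p)
  where
  none : count (¬? ∘ Q?) p ≡ 0
  none = +-cancelˡ-≡ p _ _ (trans (cong (_+ count (¬? ∘ Q?) p) (sym full))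
           (trans (count-partition Q? (¬? ∘ Q?) (λ Qi ¬Qi → ¬Qi Qi) (λ ¬Qi → ¬Qi) p)
                  (sym (+-identityʳ p))))

count≡sum : ∀ {Q : ℕ → Set} (Q? : Decidable Q) n → count Q? n ≡ sum {n} (λ j → 𝟙 (Q? (toℕ j)))
count≡sum Q? zero    = refl
count≡sum Q? (suc n) = begin
  count Q? n + 𝟙 (Q? n)
    ≡⟨ cong₂ _+_ (count≡sum Q? n) (cong (λ i → 𝟙 (Q? i)) (sym (toℕ-fromℕ n))) ⟩
  sum {n} (λ j → 𝟙 (Q? (toℕ j))) + 𝟙 (Q? (toℕ (fromℕ n)))
    ≡⟨ cong (_+ 𝟙 (Q? (toℕ (fromℕ n))))
            (sum-cong-≗ {n} {λ j → 𝟙 (Q? (toℕ j))} λ j →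
              cong (λ i → 𝟙 (Q? i)) (sym (toℕ-inject₁ j))) ⟩
  sum {n} (λ j → 𝟙 (Q? (toℕ (inject₁ j)))) + 𝟙 (Q? (toℕ (fromℕ n)))
    ≡⟨ sym (sum-init-last (λ j → 𝟙 (Q? (toℕ j)))) ⟩
  sum {suc n} (λ j → 𝟙 (Q? (toℕ j)))
    ∎
  where open ≡-Reasoning

ones : (ℕ → ℕ) → ℕ → ℕ → ℕ
ones A k = count (λ i → k ≤? A i)

module _ {Q : ℕ → Set} (Q? : Decidable Q) where

  lastAtMost : ℕ → ℕ
  lastAtMost zero    = 0
  lastAtMost (suc q) with Q? (suc q)
  ... | yes _ = suc q
  ... | no _  = lastAtMost q

  lastAtMost-≤ : ∀ q → lastAtMost q ≤ q
  lastAtMost-≤ zero = z≤n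
  lastAtMost-≤ (suc q) with Q? (suc q)
  ... | yes _ = ≤-refl
  ... | no _  = m≤n⇒m≤1+n (lastAtMost-≤ q)

  lastAtMost-satisfies : Q 0 → ∀ q → Q (lastAtMost q)
  lastAtMost-satisfies Q0 zero = Q0
  lastAtMost-satisfies Q0 (suc q) with Q? (suc q)
  ... | yes Q1+q = Q1+q
  ... | no _     = lastAtMost-satisfies Q0 q

  lastAtMost-greatest : ∀ q {r} → lastAtMost q < r → r ≤ q → ¬ Q r
  lastAtMost-greatest zero    last<r r≤0 = ⊥-elim (<⇒≱ last<r r≤0)
  lastAtMost-greatest (suc q) {r} last<r r≤1+q with Q? (suc q)
  ... | yes _    = ⊥-elim (<⇒≱ last<r r≤1+q)
  ... | no ¬Q1+q with m≤n⇒m<n∨m≡n r≤1+q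
  ...   | inj₁ (s≤s r≤q) = lastAtMost-greatest q last<r r≤q
  ...   | inj₂ refl      = ¬Q1+q

  lastAtMost-skip : ∀ {q} → ¬ Q (suc q) → lastAtMost (suc q) ≡ lastAtMost q
  lastAtMost-skip {q} ¬Q1+q with Q? (suc q)
  ... | yes Q1+q = ⊥-elim (¬Q1+q Q1+q)
  ... | no _     = refl

  lastAtMost-unique : Q 0 → ∀ {q s} → Q s → s ≤ q → (∀ {r} → s < r → r ≤ q → ¬ Q r) →
                      lastAtMost q ≡ s
  lastAtMost-unique Q0 {q} {s} Qs s≤q none-after with <-cmp (lastAtMost q) s
  ... | tri< last<s _ _ = ⊥-elim (lastAtMost-greatest q last<s s≤q Qs)
  ... | tri≈ _ last≡s _ = last≡s
  ... | tri> _ _ s<last = ⊥-elim (none-after s<last (lastAtMost-≤ q) (lastAtMost-satisfies Q0 q))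

-- Layers of compare–exchange operations

module CompareExchange {Active : ℕ → Set} (active? : Decidable Active)
                       (sparse : ∀ {p} → Active p → ¬ Active (suc p)) (A : ℕ → ℕ) where

  Exchanges : ℕ → Set
  Exchanges p = Active p × A p < A (pred p)

  exchanges? : Decidable Exchanges
  exchanges? p = active? p ×-dec (A p <? A (pred p))

  ¬exchanges-0 : ¬ Exchanges 0
  ¬exchanges-0 (_ , A0<A0) = <-irrefl refl A0<A0

  exchanges-sparse : ∀ {p} → Exchanges p → ¬ Exchanges (suc p)
  exchanges-sparse (active , _) (active′ , _) = sparse active active′

  source : ℕ → ℕ
  source i with exchanges? (suc i) | exchanges? i
  ... | yes _ | _     = suc i
  ... | no _  | yes _ = pred i
  ... | no _  | no _  = i

  source-involutive : ∀ i → source (source i) ≡ i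
  source-involutive i with exchanges? (suc i) | exchanges? i
  source-involutive i | yes x₁ | _ with exchanges? (suc (suc i)) | exchanges? (suc i)
  ... | yes x₂ | _      = ⊥-elim (exchanges-sparse x₁ x₂)
  ... | no _   | yes _  = refl
  ... | no _   | no ¬x₁ = ⊥-elim (¬x₁ x₁)
  source-involutive zero    | no _ | yes x₀ = ⊥-elim (¬exchanges-0 x₀)
  source-involutive (suc i) | no _ | yes x₀ with exchanges? (suc i)
  ... | yes _  = refl
  ... | no ¬x₀ = ⊥-elim (¬x₀ x₀)
  source-involutive i | no ¬x₁ | no ¬x₀ with exchanges? (suc i) | exchanges? i
  ... | yes x₁ | _      = ⊥-elim (¬x₁ x₁)
  ... | no _   | yes x₀ = ⊥-elim (¬x₀ x₀)
  ... | no _   | no _   = refl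

  source-near : ∀ i → ∣ source i - i ∣ ≤ 1
  source-near i with exchanges? (suc i) | exchanges? i
  source-near i       | yes _ | _     = ≤-reflexive (∣1+n-n∣≡1 i)
  source-near zero    | no _  | yes _ = z≤n
  source-near (suc i) | no _  | yes _ = ≤-reflexive (trans (∣-∣-comm i (suc i)) (∣1+n-n∣≡1 i))
  source-near i       | no _  | no _  = ≤-trans (≤-reflexive (∣n-n∣≡0 i)) z≤n

  source-< : ∀ {n} → (∀ {p} → Active p → p < n) → ∀ {i} → i < n → source i < n
  source-< bounded {i} i<n with exchanges? (suc i) | exchanges? i
  ... | yes (active , _) | _ = bounded active
  ... | no _  | yes _ = ≤-<-trans pred[n]≤n i<n
  ... | no _  | no _  = i<n

  module _ (k : ℕ) where

    onesAfter : ∀ q → Dec (Exchanges q) → ℕ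
    onesAfter q (yes _) = ones A k (pred q) + 𝟙 (k ≤? A q)
    onesAfter q (no _)  = ones A k q

    ones-source : ∀ q → ones (A ∘ source) k q ≡ onesAfter q (exchanges? q)
    ones-source zero with exchanges? 0
    ... | yes x₀ = ⊥-elim (¬exchanges-0 x₀)
    ... | no _   = refl
    ones-source (suc q) with exchanges? (suc q) | exchanges? q | ones-source q
    ... | yes x₁ | yes x₀ | _  = ⊥-elim (exchanges-sparse x₀ x₁)
    ... | yes _  | no _   | ih = cong (_+ 𝟙 (k ≤? A (suc q))) ih
    ... | no _   | yes x₀ | ih = swapped-back q x₀ ih
      where
      swapped-back : ∀ q → Exchanges q → ones (A ∘ source) k q ≡ ones A k (pred q) + 𝟙 (k ≤? A q) →
                     ones (A ∘ source) k q + 𝟙 (k ≤? A (pred q)) ≡ ones A k q + 𝟙 (k ≤? A q)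
      swapped-back zero    x₀ _  = ⊥-elim (¬exchanges-0 x₀)
      swapped-back (suc q) _  eq = trans (cong (_+ 𝟙 (k ≤? A q)) eq) (xy∙z≈xz∙y (ones A k q) _ _)
    ... | no _   | no _   | ih = cong (_+ 𝟙 (k ≤? A q)) ih

    ones-inactive : ∀ {q} → ¬ Active q → ones (A ∘ source) k q ≡ ones A k q
    ones-inactive {q} ¬active with exchanges? q | ones-source q
    ... | yes (active , _) | _  = ⊥-elim (¬active active)
    ... | no _             | eq = eq

    at-most-one-lost : ∀ o {X Y : Set} (x : Dec X) (y : Dec Y) → (X → Y) →
                       o + 𝟙 x ≤ o ⊔ (o + 𝟙 x + 𝟙 y ∸ 1)
    at-most-one-lost o (yes _) (yes _)  _   = ≤-trans (≤-reflexive (sym (m+n∸n≡m (o + 1) 1))) (m≤n⊔m o _)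
    at-most-one-lost o (yes X) (no ¬Y)  X→Y = ⊥-elim (¬Y (X→Y X))
    at-most-one-lost o (no _)  _        _   = ≤-trans (≤-reflexive (+-identityʳ o)) (m≤m⊔n o _)

    ones-active : ∀ {p} → Active p → ones (A ∘ source) k p ≤ ones A k (pred p) ⊔ (ones A k (suc p) ∸ 1)
    ones-active {zero}  _      = z≤n
    ones-active {suc p} active with exchanges? (suc p) | ones-source (suc p)
    ... | yes (_ , A1+p<Ap) | eq = ≤-trans (≤-reflexive eq) (begin
      o + 𝟙 (k ≤? A (suc p))                            ≤⟨ at-most-one-lost o (k ≤? A (suc p)) (k ≤? A p)
                                                             (λ k≤A1+p → <⇒≤ (≤-<-trans k≤A1+p A1+p<Ap)) ⟩
      o ⊔ (o + 𝟙 (k ≤? A (suc p)) + 𝟙 (k ≤? A p) ∸ 1)  ≡⟨ cong (λ x → o ⊔ (x ∸ 1))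
                                                               (xy∙z≈xz∙y o _ _) ⟩
      o ⊔ (ones A k (suc (suc p)) ∸ 1)                  ∎)
      where
      open ≤-Reasoning
      o : ℕ
      o = ones A k p
    ... | no ¬x | eq = ≤-trans (≤-reflexive eq)
      (at-most-one-lost (ones A k p) (k ≤? A p) (k ≤? A (suc p))
        (λ k≤Ap → ≤-trans k≤Ap (≮⇒≥ λ A1+p<Ap → ¬x (active , A1+p<Ap))))

deflationary-injection⇒id : ∀ {n} (f : ℕ → ℕ) →
  (∀ {x y} → x < n → y < n → f x ≡ f y → x ≡ y) → (∀ {x} → x < n → f x ≤ x) →
  ∀ x → x < n → f x ≡ x
deflationary-injection⇒id {n} f injective deflationary = <-rec (λ x → x < n → f x ≡ x) step
  where
  step : ∀ x → (∀ {y} → y < x → y < n → f y ≡ y) → x < n → f x ≡ x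
  step x fixed-below x<n with m≤n⇒m<n∨m≡n (deflationary x<n)
  ... | inj₂ fx≡x = fx≡x
  ... | inj₁ fx<x = ⊥-elim (<-irrefl (injective fx<n x<n (fixed-below fx<x fx<n)) fx<x)
    where
    fx<n : f x < n
    fx<n = <-trans fx<x x<n

involution⇒permutation : ∀ n (f : ℕ → ℕ) → (∀ {i} → i < n → f i < n) → (∀ i → f (f i) ≡ i) →
                          Permutation′ n
involution⇒permutation n f f-< f-involutive = permutation f′ f′ f′-involutive f′-involutive
  where
  f′ : Fin n → Fin n
  f′ j = fromℕ< (f-< (toℕ<n j))
  f′-involutive : ∀ j → f′ (f′ j) ≡ j
  f′-involutive j = toℕ-injective
    (trans (toℕ-fromℕ< _) (trans (cong f (toℕ-fromℕ< _)) (f-involutive (toℕ j))))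

toℕ-involution⇒permutation : ∀ n f (f-< : ∀ {i} → i < n → f i < n) (f-involutive : ∀ i → f (f i) ≡ i)
                             (j : Fin n) → toℕ (c (involution⇒permutation n f f-< f-involutive) j) ≡ f (toℕ j)
toℕ-involution⇒permutation n f f-< f-involutive j = toℕ-fromℕ< _

productCol-∷ʳ : ∀ {n} (Qs : List (Permutation′ n)) Q i →
                productCol (Qs ++ Q ∷ []) i ≡ c Q (productCol Qs i)
productCol-∷ʳ []       Q i = refl
productCol-∷ʳ (Q′ ∷ Qs) Q i = productCol-∷ʳ Qs Q (c Q′ i)

-- Odd–even transposition sort within sections

module OddEvenSort (n w : ℕ) (1≤w : 1 ≤ w) (a : ℕ → ℕ)
  (a-< : ∀ {i} → i < n → a i < n)
  (a-injective : ∀ {i j} → i < n → j < n → a i ≡ a j → i ≡ j)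
  (a-band : ∀ i → ∣ a i - i ∣ ≤ w)
  (count-a : ∀ {Q : ℕ → Set} (Q? : Decidable Q) → count (Q? ∘ a) n ≡ count Q? n)
  where

  a≤i+w : ∀ i → a i ≤ i + w
  a≤i+w i = ≤-trans (m≤n+∣m-n∣ (a i) i) (+-monoʳ-≤ i (a-band i))

  i≤a+w : ∀ i → i ≤ a i + w
  i≤a+w i = ≤-trans (m≤n+∣m-n∣ i (a i))
                    (+-monoʳ-≤ (a i) (subst (_≤ w) (∣-∣-comm (a i) i) (a-band i)))

  ones-a≤p+w∸k : ∀ k p → ones a k p ≤ p + w ∸ k
  ones-a≤p+w∸k k p = ≤-trans (count-none-below (λ i → k ≤? a i) small p) (m∸[n∸o]≤m+o∸n p k w)
    where
    small : ∀ {i} → i < k ∸ w → ¬ k ≤ a i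
    small {i} i<k∸w k≤ai = <⇒≱ (≤-<-trans (a≤i+w i) i+w<k) k≤ai
      where
      i+w<k : i + w < k
      i+w<k = m≤o∸n⇒m+n≤o (suc i) (<⇒≤ (m∸n≢0⇒n<m λ k∸w≡0 → n≮0 (subst (i <_) k∸w≡0 i<k∸w)))
                            i<k∸w

  ones-a+k≤p+[k+w∸p] : ∀ {k p} → k ≤ p → p ≤ n → ones a k p + k ≤ p + (k + w ∸ p)
  ones-a+k≤p+[k+w∸p] {k} {p} k≤p p≤n = begin
    ones a k p + k                                   ≡⟨ cong (ones a k p +_) (sym all-small) ⟩
    ones a k p + count small? n                      ≡⟨ cong (λ q → ones a k p + count small? q)
                                                             (sym (m+[n∸m]≡n p≤n)) ⟩
    ones a k p + count small? (p + (n ∸ p))          ≡⟨ cong (ones a k p +_) (count-split small? p (n ∸ p)) ⟩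
    ones a k p + (count small? p + late)             ≡⟨ sym (+-assoc (ones a k p) _ late) ⟩
    ones a k p + count small? p + late               ≡⟨ cong (_+ late) (count-partition (λ i → k ≤? a i) small?
                                                             (λ k≤ai ai<k → <⇒≱ ai<k k≤ai) ≰⇒> p) ⟩
    p + late                                         ≤⟨ +-monoʳ-≤ p (≤-trans (count-none-above _ before (n ∸ p))
                                                                             (count-≤ _ _)) ⟩
    p + (k + w ∸ p)                                  ∎
    where
    open ≤-Reasoning
    small? : Decidable (λ i → a i < k)
    small? i = a i <? k
    late : ℕ
    late = count (λ j → small? (p + j)) (n ∸ p)
    all-small : count small? n ≡ k
    all-small = trans (count-a (_<? k)) (trans (count-<? k n) (m≥n⇒m⊓n≡n (≤-trans k≤p p≤n)))
    before : ∀ {j} → a (p + j) < k → j < k + w ∸ p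
    before {j} a<k = m+n≤o⇒m≤o∸n (suc j) (≤-trans (≤-reflexive (+-comm (suc j) p))
      (subst (_≤ k + w) (sym (+-suc p j)) (≤-trans (s≤s (i≤a+w (p + j))) (+-monoˡ-≤ w a<k))))

  IsCut : ℕ → Set
  IsCut q = ∀ {i} → i < q → a i < q

  cut? : Decidable IsCut
  cut? q = allUpTo? (λ i → a i <? q) q

  cut-0 : IsCut 0
  cut-0 ()

  cut-n : IsCut n
  cut-n = a-<

  ones-a≤q∸k : ∀ k {q} → IsCut q → q ≤ n → ones a k q ≤ q ∸ k
  ones-a≤q∸k k {q} cut q≤n = begin
    ones a k q                ≤⟨ count-⊆ (λ i → k ≤? a i) (between? ∘ a)
                                           (λ i<q k≤ai → k≤ai , cut i<q) ⟩
    count (between? ∘ a) q    ≤⟨ count-mono (between? ∘ a) q≤n ⟩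
    count (between? ∘ a) n    ≡⟨ count-a between? ⟩
    count between? n          ≤⟨ count-none-above between? proj₂ n ⟩
    count between? q          ≤⟨ count-none-below between? (λ j<k (k≤j , _) → <⇒≱ j<k k≤j) q ⟩
    q ∸ k                     ∎
    where
    open ≤-Reasoning
    between? : Decidable (λ j → k ≤ j × j < q)
    between? j = (k ≤? j) ×-dec (j <? q)

  sectionStart : ℕ → ℕ
  sectionStart = lastAtMost cut?

  -- The summand w in the parity is what makes α ≤ 2w in the case D = w of Threshold.
  Active : ℕ → ℕ → Set
  Active t p = p < n × ¬ IsCut p × parity (p + t + sectionStart (pred p) + w) ≡ 1ℙ

  active? : ∀ t → Decidable (Active t)
  active? t p = (p <? n) ×-dec (¬? (cut? p) ×-dec
                (parity (p + t + sectionStart (pred p) + w) Parity.≟ 1ℙ))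

  active-sparse : ∀ t {p} → Active t p → ¬ Active t (suc p)
  active-sparse t {zero}  (_ , ¬cut , _) _ = ¬cut cut-0
  active-sparse t {suc p} (_ , ¬cut , odd) (_ , _ , odd′) = Parity.p≢p⁻¹ 1ℙ (begin
    1ℙ
      ≡⟨ sym odd ⟩
    parity (suc p + t + sectionStart p + w)
      ≡⟨ sym (Parity.suc-homo-⁻¹ (suc p + t + sectionStart p + w)) ⟩
    parity (suc (suc p) + t + sectionStart p + w) ⁻¹
      ≡⟨ cong (λ s → parity (suc (suc p) + t + s + w) ⁻¹) (sym (lastAtMost-skip cut? ¬cut)) ⟩
    parity (suc (suc p) + t + sectionStart (suc p) + w) ⁻¹
      ≡⟨ cong _⁻¹ odd′ ⟩
    1ℙ ⁻¹
      ∎)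
    where open ≡-Reasoning

  module Round t = CompareExchange (active? t) (active-sparse t)

  state : ℕ → ℕ → ℕ
  state zero    = a
  state (suc t) = state t ∘ Round.source (suc t) (state t)

  ones-state-cut : ∀ k {q} → IsCut q → ∀ t → ones (state t) k q ≡ ones a k q
  ones-state-cut k cut zero    = refl
  ones-state-cut k cut (suc t) =
    trans (Round.ones-inactive (suc t) (state t) k (λ (_ , ¬cut , _) → ¬cut cut)) (ones-state-cut k cut t)

  rounds : ℕ
  rounds = 2 * w ∸ 1

  module Threshold (k : ℕ) (k≤n : k ≤ n) (¬cut-k : ¬ IsCut k) where

    s : ℕ
    s = sectionStart (pred k)

    s-cut : IsCut s
    s-cut = lastAtMost-satisfies cut? cut-0 (pred k)

    1≤k : 1 ≤ k
    1≤k = n≢0⇒n>0 λ k≡0 → ¬cut-k (subst IsCut (sym k≡0) cut-0)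

    s<k : s < k
    s<k = m≤pred[n]⇒suc[m]≤n ⦃ >-nonZero 1≤k ⦄ (lastAtMost-≤ cut? (pred k))

    D : ℕ
    D = ones a k k

    ε : ℕ
    ε = bit (parity (D + k + s))

    α : ℕ
    α = D + w + ε

    bound : ℕ → ℕ → ℕ
    bound p t = ⌊ (p + α) ∸ (k + t) /2⌋ ⊔ (p ∸ k)

    Within : ℕ → Set
    Within p = s < p × (∀ {r} → s < r → r < p → ¬ IsCut r)

    within-k : Within k
    within-k = s<k , λ s<r r<k → lastAtMost-greatest cut? (pred k) s<r (suc[m]≤n⇒m≤pred[n] r<k)

    within-≤n : ∀ {p} → Within p → p ≤ n
    within-≤n {p} (s<p , no-cut) = ≮⇒≥ λ n<p → no-cut (<-≤-trans s<k k≤n) n<p cut-n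

    within-<n : ∀ {p} → Within p → ¬ IsCut p → p < n
    within-<n within ¬cut = ≤∧≢⇒< (within-≤n within) λ { refl → ¬cut cut-n }

    within-start : ∀ {p} → Within (suc p) → sectionStart p ≡ s
    within-start (s<1+p , no-cut) =
      lastAtMost-unique cut? cut-0 s-cut (s≤s⁻¹ s<1+p) (λ s<r r≤p → no-cut s<r (s≤s r≤p))

    within-pred : ∀ {p} → Within (suc p) → s < p → Within p
    within-pred (_ , no-cut) s<p = s<p , λ s<r r<p → no-cut s<r (m<n⇒m<1+n r<p)

    within-suc : ∀ {p} → Within p → ¬ IsCut p → Within (suc p)
    within-suc {p} (s<p , no-cut) ¬cut = m<n⇒m<1+n s<p , no-cut′
      where
      no-cut′ : ∀ {r} → s < r → r < suc p → ¬ IsCut r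
      no-cut′ s<r r<1+p with m≤n⇒m<n∨m≡n (s≤s⁻¹ r<1+p)
      ... | inj₁ r<p  = no-cut s<r r<p
      ... | inj₂ refl = ¬cut

    α-parity : parity (α + k + (s + w)) ≡ 0ℙ
    α-parity = begin
      parity (α + k + (s + w))                ≡⟨ cong parity (regroup D k s w ε) ⟩
      parity (D + k + s + ε + (w + w))        ≡⟨ parity-+-double (D + k + s + ε) w ⟩
      parity (D + k + s + ε)                  ≡⟨ Parity.+-homo-+ (D + k + s) ε ⟩
      parity (D + k + s) +ℙ parity ε          ≡⟨ cong (parity (D + k + s) +ℙ_) (parity-bit _) ⟩
      parity (D + k + s) +ℙ parity (D + k + s) ≡⟨ Parity.p+p≡0ℙ (parity (D + k + s)) ⟩
      0ℙ                                      ∎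
      where
      open ≡-Reasoning
      regroup : ∀ d k s w e → d + w + e + k + (s + w) ≡ d + k + s + e + (w + w)
      regroup = solve-∀

    bound-step-idle : ∀ p t → parity (p + suc t + s + w) ≡ 0ℙ → bound p t ≤ bound p (suc t)
    bound-step-idle p t even = ⊔-monoˡ-≤ (p ∸ k)
      (≤-trans (⌊∸/2⌋-odd (p + α) (k + t) odd)
               (≤-reflexive (cong (λ x → ⌊ (p + α) ∸ x /2⌋) (sym (+-suc k t)))))
      where
      odd : parity (p + α + (k + t)) ≡ 1ℙ
      odd = parity-suc (p + α + (k + t)) (begin
        parity (suc (p + α + (k + t)))
          ≡⟨ sym (parity-+-double (suc (p + α + (k + t))) (s + w)) ⟩
        parity (suc (p + α + (k + t)) + (s + w + (s + w)))
          ≡⟨ cong parity (regroup p α k t s w) ⟩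
        parity (p + suc t + s + w + (α + k + (s + w)))
          ≡⟨ Parity.+-homo-+ (p + suc t + s + w) _ ⟩
        parity (p + suc t + s + w) +ℙ parity (α + k + (s + w))
          ≡⟨ cong₂ _+ℙ_ even α-parity ⟩
        0ℙ
          ∎)
        where
        open ≡-Reasoning
        regroup : ∀ p α k t s w →
                  suc (p + α + (k + t)) + (s + w + (s + w)) ≡ p + suc t + s + w + (α + k + (s + w))
        regroup = solve-∀

    bound-step-left : ∀ p t → bound p t ≤ bound (suc p) (suc t)
    bound-step-left p t = ⊔-mono-≤ (≤-reflexive (cong (λ x → ⌊ suc (p + α) ∸ x /2⌋) (sym (+-suc k t))))
                          (∸-monoˡ-≤ k (n≤1+n p))

    bound-step-right : ∀ p t → bound (suc p) t ∸ 1 ≤ bound p (suc t)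
    bound-step-right p t = ≤-reflexive (begin
      bound (suc p) t ∸ 1
        ≡⟨ ∸-distribʳ-⊔ 1 (⌊ suc (p + α) ∸ (k + t) /2⌋) (suc p ∸ k) ⟩
      (⌊ suc (p + α) ∸ (k + t) /2⌋ ∸ 1) ⊔ (suc p ∸ k ∸ 1)
        ≡⟨ cong₂ _⊔_ (⌊suc∸/2⌋∸1 (p + α) (k + t))
                     (trans (∸-+-assoc (suc p) k 1) (cong (suc p ∸_) (+-comm k 1))) ⟩
      ⌊ (p + α) ∸ suc (k + t) /2⌋ ⊔ (p ∸ k)
        ≡⟨ cong (λ x → ⌊ (p + α) ∸ x /2⌋ ⊔ (p ∸ k)) (sym (+-suc k t)) ⟩
      bound p (suc t)
        ∎)
      where open ≡-Reasoning

    module Tight (D≡w : D ≡ w) where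

      w≤k : w ≤ k
      w≤k = subst (_≤ k) D≡w (count-≤ _ k)

      m : ℕ
      m = k ∸ w

      m+w≡k : m + w ≡ k
      m+w≡k = m∸n+n≡m w≤k

      m<k : m < k
      m<k = subst (m <_) m+w≡k (subst (_≤ m + w) (+-comm m 1) (+-monoʳ-≤ m 1≤w))

      high : ∀ {j} → m ≤ j → j < k → k ≤ a j
      high {j} m≤j j<k = subst (λ i → k ≤ a i) (m+[n∸m]≡n m≤j)
        (count≡p⇒ (λ i → k ≤? a (m + i)) window-full
                  (subst (j ∸ m <_) (m∸[m∸n]≡n w≤k) (∸-monoˡ-< j<k m≤j)))
        where
        window-full : count (λ i → k ≤? a (m + i)) w ≡ w
        window-full = begin
          count (λ i → k ≤? a (m + i)) w                 ≡⟨ cong (_+ count (λ i → k ≤? a (m + i)) w)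
                                                                 (sym none-before) ⟩
          ones a k m + count (λ i → k ≤? a (m + i)) w    ≡⟨ sym (count-split (λ i → k ≤? a i) m w) ⟩
          ones a k (m + w)                               ≡⟨ cong (ones a k) m+w≡k ⟩
          D                                              ≡⟨ D≡w ⟩
          w                                              ∎
          where
          open ≡-Reasoning
          none-before : ones a k m ≡ 0
          none-before = n≤0⇒n≡0 (≤-trans (ones-a≤p+w∸k k m)
                                         (≤-reflexive (trans (cong (_∸ k) m+w≡k) (n∸n≡0 k))))

      small-early : ∀ {j} → a j < m → j < m
      small-early {j} aj<m with m ≤? j
      ... | no m≰j  = ≰⇒> m≰j
      ... | yes m≤j = ⊥-elim (<⇒≱ (<-trans aj<m m<k) (high m≤j j<k))
        where
        j<k : j < k
        j<k = ≤-<-trans (i≤a+w j) (subst (a j + w <_) m+w≡k (+-monoˡ-< w aj<m))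

      m-cut : IsCut m
      m-cut i<m = ≰⇒> (count≡0⇒¬ (λ i → m ≤? a i) no-large i<m)
        where
        small? : Decidable (λ i → a i < m)
        small? i = a i <? m
        all-small-early : m ≤ count small? m
        all-small-early = begin
          m                   ≡⟨ sym (m≥n⇒m⊓n≡n (≤-trans (<⇒≤ m<k) k≤n)) ⟩
          n ⊓ m               ≡⟨ sym (trans (count-a (_<? m)) (count-<? m n)) ⟩
          count small? n      ≤⟨ count-none-above small? small-early n ⟩
          count small? m      ∎
          where open ≤-Reasoning
        no-large : ones a m m ≡ 0
        no-large = n≤0⇒n≡0 (+-cancelʳ-≤ (count small? m) _ _ (begin
          ones a m m + count small? m   ≡⟨ count-partition (λ i → m ≤? a i) small?
                                                (λ m≤ai ai<m → <⇒≱ ai<m m≤ai) ≰⇒> m ⟩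
          m                             ≤⟨ all-small-early ⟩
          count small? m                ∎))
          where open ≤-Reasoning

      s≡m : s ≡ m
      s≡m = lastAtMost-unique cut? cut-0 m-cut (suc[m]≤n⇒m≤pred[n] m<k)
        λ m<r r≤k-1 cut-r → <⇒≱ (<-≤-trans (cut-r m<r) (≤-trans r≤k-1 pred[n]≤n)) (high ≤-refl m<k)

      parity-even : parity (D + k + s) ≡ 0ℙ
      parity-even = begin
        parity (D + k + s)     ≡⟨ cong₂ (λ d s → parity (d + k + s)) D≡w s≡m ⟩
        parity (w + k + m)     ≡⟨ cong parity (trans (regroup w k m) (cong (k +_) m+w≡k)) ⟩
        parity (0 + (k + k))   ≡⟨ parity-+-double 0 k ⟩
        0ℙ                     ∎
        where
        open ≡-Reasoning
        regroup : ∀ w k m → w + k + m ≡ 0 + (k + (m + w))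
        regroup = solve-∀

    D≤w : D ≤ w
    D≤w = ≤-trans (ones-a≤p+w∸k k k) (≤-reflexive (m+n∸m≡n k w))

    α≤2w : α ≤ 2 * w
    α≤2w with m≤n⇒m<n∨m≡n D≤w
    ... | inj₁ D<w = begin
      D + w + ε   ≤⟨ +-monoʳ-≤ (D + w) (bit≤1 _) ⟩
      D + w + 1   ≡⟨ trans (+-assoc D w 1) (trans (cong (D +_) (+-comm w 1)) (+-suc D w)) ⟩
      suc D + w   ≤⟨ +-monoˡ-≤ w D<w ⟩
      w + w       ≡⟨ cong (w +_) (sym (+-identityʳ w)) ⟩
      2 * w       ∎
      where open ≤-Reasoning
    ... | inj₂ D≡w = ≤-reflexive (begin
      D + w + ε   ≡⟨ cong (λ e → D + w + bit e) (Tight.parity-even D≡w) ⟩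
      D + w + 0   ≡⟨ +-identityʳ (D + w) ⟩
      D + w       ≡⟨ cong₂ _+_ D≡w (sym (+-identityʳ w)) ⟩
      2 * w       ∎)
      where open ≡-Reasoning

    w+D≤α : w + D ≤ α
    w+D≤α = ≤-trans (≤-reflexive (+-comm w D)) (m≤m+n (D + w) _)

    ones-a≤bound-below : ∀ {p} → p ≤ k → ones a k p ≤ bound p 0
    ones-a≤bound-below {p} p≤k with k ≤? p + w
    ... | no k≰p+w  = ≤-trans (ones-a≤p+w∸k k p)
                              (≤-trans (≤-reflexive (m≤n⇒m∸n≡0 (<⇒≤ (≰⇒> k≰p+w)))) z≤n)
    ... | yes k≤p+w = ≤-trans (≤⌊+/2⌋ (ones-a≤p+w∸k k p) (count-mono _ p≤k))
                              (≤-trans (⌊n/2⌋-mono total≤) (m≤m⊔n _ _))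
      where
      total≤ : p + w ∸ k + D ≤ p + α ∸ (k + 0)
      total≤ = begin
        p + w ∸ k + D      ≡⟨ sym (+-∸-comm D k≤p+w) ⟩
        p + w + D ∸ k      ≤⟨ ∸-monoˡ-≤ k (≤-trans (≤-reflexive (+-assoc p w D)) (+-monoʳ-≤ p w+D≤α)) ⟩
        p + α ∸ k          ≡⟨ cong (p + α ∸_) (sym (+-identityʳ k)) ⟩
        p + α ∸ (k + 0)    ∎
        where open ≤-Reasoning

    ones-a≤bound-above : ∀ {p} → k ≤ p → p ≤ n → ones a k p ≤ bound p 0
    ones-a≤bound-above {p} k≤p p≤n with k + w ≤? p
    ... | yes k+w≤p = ≤-trans (m+n≤o⇒m≤o∸n (ones a k p) (≤-trans (ones-a+k≤p+[k+w∸p] k≤p p≤n) p+[k+w∸p]≤p))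
                              (m≤n⊔m _ _)
      where
      p+[k+w∸p]≤p : p + (k + w ∸ p) ≤ p
      p+[k+w∸p]≤p = ≤-reflexive (trans (cong (p +_) (m≤n⇒m∸n≡0 k+w≤p)) (+-identityʳ p))
    ... | no k+w≰p  = ≤-trans (≤⌊+/2⌋ (count-≤-+∸ _ k p) at-most-w)
                              (≤-trans (⌊n/2⌋-mono total≤) (m≤m⊔n _ _))
      where
      at-most-w : ones a k p ≤ w
      at-most-w = subst (ones a k p ≤_) (m+n∸m≡n k w) (m+n≤o⇒m≤o∸n (ones a k p)
        (≤-trans (ones-a+k≤p+[k+w∸p] k≤p p≤n) (≤-reflexive (m+[n∸m]≡n (<⇒≤ (≰⇒> k+w≰p))))))
      total≤ : D + (p ∸ k) + w ≤ p + α ∸ (k + 0)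
      total≤ = begin
        D + (p ∸ k) + w    ≡⟨ regroup D (p ∸ k) w ⟩
        p ∸ k + (w + D)    ≡⟨ sym (+-∸-comm (w + D) k≤p) ⟩
        p + (w + D) ∸ k    ≤⟨ ∸-monoˡ-≤ k (+-monoʳ-≤ p w+D≤α) ⟩
        p + α ∸ k          ≡⟨ cong (p + α ∸_) (sym (+-identityʳ k)) ⟩
        p + α ∸ (k + 0)    ∎
        where
        open ≤-Reasoning
        regroup : ∀ d x w → d + x + w ≡ x + (w + d)
        regroup = solve-∀

    ones-a≤bound : ∀ {p} → p ≤ n → ones a k p ≤ bound p 0
    ones-a≤bound {p} p≤n with p ≤? k
    ... | yes p≤k = ones-a≤bound-below p≤k
    ... | no p≰k  = ones-a≤bound-above (<⇒≤ (≰⇒> p≰k)) p≤n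

    ones-state-start≡0 : ∀ t → ones (state t) k s ≡ 0
    ones-state-start≡0 t = trans (ones-state-cut k s-cut t)
      (n≤0⇒n≡0 (≤-trans (ones-a≤q∸k k s-cut (<⇒≤ (<-≤-trans s<k k≤n)))
                        (≤-reflexive (m≤n⇒m∸n≡0 (<⇒≤ s<k)))))

    ones-state≤bound-at-cut : ∀ t {q} → IsCut q → q ≤ n → ones (state t) k q ≤ bound q t
    ones-state≤bound-at-cut t cut q≤n =
      ≤-trans (≤-reflexive (ones-state-cut k cut t)) (≤-trans (ones-a≤q∸k k cut q≤n) (m≤n⊔m _ _))

    ones-state≤bound : ∀ t {p} → Within p → ones (state t) k p ≤ bound p t
    ones-state≤bound t {zero} (() , _)
    ones-state≤bound t {suc p} within with cut? (suc p)
    ones-state≤bound t {suc p} within | yes cut = ones-state≤bound-at-cut t cut (within-≤n within)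
    ones-state≤bound zero      within | no _    = ones-a≤bound (within-≤n within)
    ones-state≤bound (suc t) {suc p} within | no ¬cut = step (active? (suc t) (suc p))
      where
      step : Dec (Active (suc t) (suc p)) → ones (state (suc t)) k (suc p) ≤ bound (suc p) (suc t)
      step (yes active) = ≤-trans (Round.ones-active (suc t) (state t) k active) (⊔-lub left right)
        where
        left : ones (state t) k p ≤ bound (suc p) (suc t)
        left with s ≟ p
        ... | yes s≡p = ≤-trans (≤-reflexive (trans (cong (ones (state t) k) (sym s≡p)) (ones-state-start≡0 t)))
                                z≤n
        ... | no s≢p  = ≤-trans (ones-state≤bound t (within-pred within (≤∧≢⇒< (s≤s⁻¹ (proj₁ within)) s≢p)))
                                (bound-step-left p t)
        right : ones (state t) k (suc (suc p)) ∸ 1 ≤ bound (suc p) (suc t)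
        right = ≤-trans (∸-monoˡ-≤ 1 (ones-state≤bound t (within-suc within ¬cut)))
                        (bound-step-right (suc p) t)
      step (no ¬active) = ≤-trans (≤-reflexive (Round.ones-inactive (suc t) (state t) k ¬active))
                                  (≤-trans (ones-state≤bound t within) (bound-step-idle (suc p) t even))
        where
        even : parity (suc p + suc t + s + w) ≡ 0ℙ
        even with parity (suc p + suc t + s + w) in eq
        ... | 0ℙ = refl
        ... | 1ℙ = ⊥-elim (¬active (within-<n within ¬cut , ¬cut ,
                     trans (cong (λ x → parity (suc p + suc t + x + w)) (within-start within)) eq))

    ones-final≡0-at-k : ones (state rounds) k k ≡ 0
    ones-final≡0-at-k = n≤0⇒n≡0 (≤-trans (ones-state≤bound rounds within-k) (≤-reflexive bound-final))
      where
      bound-final : bound k rounds ≡ 0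
      bound-final = cong₂ _⊔_
        (trans (cong ⌊_/2⌋ ([m+n]∸[m+o]≡n∸o k α rounds)) (⌊≤1/2⌋ (α ∸ rounds) α∸rounds≤1)) (n∸n≡0 k)
        where
        α∸rounds≤1 : α ∸ rounds ≤ 1
        α∸rounds≤1 = ≤-trans (∸-monoˡ-≤ rounds α≤2w) (≤-reflexive (m∸[m∸n]≡n (≤-trans 1≤w (m≤m+n w _))))
        ⌊≤1/2⌋ : ∀ x → x ≤ 1 → ⌊ x /2⌋ ≡ 0
        ⌊≤1/2⌋ zero          _ = refl
        ⌊≤1/2⌋ (suc zero)    _ = refl
        ⌊≤1/2⌋ (suc (suc x)) (s≤s ())

  ones-final≡0 : ∀ x → x < n → ones (state rounds) (suc x) (suc x) ≡ 0
  ones-final≡0 x x<n with cut? (suc x)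
  ... | yes cut = trans (ones-state-cut (suc x) cut rounds)
                    (n≤0⇒n≡0 (≤-trans (ones-a≤q∸k (suc x) cut x<n) (≤-reflexive (n∸n≡0 (suc x)))))
  ... | no ¬cut = Threshold.ones-final≡0-at-k (suc x) x<n ¬cut

  state-injective : ∀ t {x y} → x < n → y < n → state t x ≡ state t y → x ≡ y
  state-injective zero              = a-injective
  state-injective (suc t) {x} {y} x<n y<n eq = begin
    x                  ≡⟨ sym (source-involutive x) ⟩
    source (source x)  ≡⟨ cong source (state-injective t (source-< proj₁ x<n) (source-< proj₁ y<n) eq) ⟩
    source (source y)  ≡⟨ source-involutive y ⟩
    y                  ∎
    where
    open ≡-Reasoning
    open Round (suc t) (state t)

  sorted : ∀ x → x < n → state rounds x ≡ x
  sorted = deflationary-injection⇒id (state rounds) (state-injective rounds) deflationary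
    where
    deflationary : ∀ {x} → x < n → state rounds x ≤ x
    deflationary {x} x<n =
      s≤s⁻¹ (≰⇒> (count≡0⇒¬ (λ i → suc x ≤? state rounds i) (ones-final≡0 x x<n) (n<1+n x)))

  layer : ℕ → Permutation′ n
  layer t = involution⇒permutation n source (source-< proj₁) source-involutive
    where open Round (suc t) (state t)

  layers : ℕ → List (Permutation′ n)
  layers zero    = []
  layers (suc t) = layers t ++ layer t ∷ []

  length-layers : ∀ t → length (layers t) ≡ t
  length-layers zero    = refl
  length-layers (suc t) = trans (length-++ (layers t)) (trans (cong (_+ 1) (length-layers t)) (+-comm t 1))

  layers-bandwidth≤1 : ∀ t → AllBandwidth≤1 (layers t)
  layers-bandwidth≤1 zero    = []
  layers-bandwidth≤1 (suc t) = ++⁺ (layers-bandwidth≤1 t) (bandwidth≤1 ∷ [])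
    where
    open Round (suc t) (state t)
    bandwidth≤1 : BandwidthAtMost (layer t) 1
    bandwidth≤1 i = subst (λ j → ∣ j - toℕ i ∣ ≤ 1)
      (sym (toℕ-involution⇒permutation n source (source-< proj₁) source-involutive i)) (source-near (toℕ i))

  state-layers : ∀ t (y : Fin n) → state t (toℕ (productCol (layers t) y)) ≡ a (toℕ y)
  state-layers zero    y = refl
  state-layers (suc t) y = begin
    state t (source (toℕ (productCol (layers t ++ layer t ∷ []) y)))
      ≡⟨ cong (state t ∘ source ∘ toℕ) (productCol-∷ʳ (layers t) (layer t) y) ⟩
    state t (source (toℕ (c (layer t) (productCol (layers t) y))))
      ≡⟨ cong (state t ∘ source) (toℕ-involution⇒permutation n source (source-< proj₁) source-involutive _) ⟩
    state t (source (source (toℕ (productCol (layers t) y))))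
      ≡⟨ cong (state t) (source-involutive _) ⟩
    state t (toℕ (productCol (layers t) y))
      ≡⟨ state-layers t y ⟩
    a (toℕ y)
      ∎
    where
    open ≡-Reasoning
    open Round (suc t) (state t)

  toℕ-productCol-layers : ∀ (y : Fin n) → toℕ (productCol (layers rounds) y) ≡ a (toℕ y)
  toℕ-productCol-layers y = trans (sym (sorted _ (toℕ<n _))) (state-layers rounds y)

module _ {n : ℕ} (P : Permutation′ n) where

  -- Padded with the identity outside the matrix, so that the bandwidth bound holds everywhere.
  column : ℕ → ℕ
  column i with i <? n
  ... | yes i<n = toℕ (c P (fromℕ< i<n))
  ... | no _    = i

  column-fromℕ< : ∀ {i} (i<n : i < n) → column i ≡ toℕ (c P (fromℕ< i<n))
  column-fromℕ< {i} i<n with i <? n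
  ... | yes _   = refl
  ... | no i≮n  = ⊥-elim (i≮n i<n)

  column-toℕ : ∀ j → column (toℕ j) ≡ toℕ (c P j)
  column-toℕ j = trans (column-fromℕ< (toℕ<n j)) (cong (toℕ ∘ c P) (fromℕ<-toℕ j (toℕ<n j)))

  column-< : ∀ {i} → i < n → column i < n
  column-< i<n = subst (_< n) (sym (column-fromℕ< i<n)) (toℕ<n _)

  column-injective : ∀ {i j} → i < n → j < n → column i ≡ column j → i ≡ j
  column-injective {i} {j} i<n j<n eq = begin
    i                                           ≡⟨ sym (toℕ-fromℕ< i<n) ⟩
    toℕ (fromℕ< i<n)                            ≡⟨ cong toℕ (sym (inverseˡ P)) ⟩
    toℕ (P ⟨$⟩ˡ (c P (fromℕ< i<n)))             ≡⟨ cong (toℕ ∘ (P ⟨$⟩ˡ_)) (toℕ-injective same-column) ⟩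
    toℕ (P ⟨$⟩ˡ (c P (fromℕ< j<n)))             ≡⟨ cong toℕ (inverseˡ P) ⟩
    toℕ (fromℕ< j<n)                            ≡⟨ toℕ-fromℕ< j<n ⟩
    j                                           ∎
    where
    open ≡-Reasoning
    same-column : toℕ (c P (fromℕ< i<n)) ≡ toℕ (c P (fromℕ< j<n))
    same-column = trans (sym (column-fromℕ< i<n)) (trans eq (column-fromℕ< j<n))

  column-bandwidth : ∀ {w} → BandwidthAtMost P w → ∀ i → ∣ column i - i ∣ ≤ w
  column-bandwidth {w} bandwidth i with i <? n
  ... | yes i<n = subst (λ x → ∣ toℕ (c P (fromℕ< i<n)) - x ∣ ≤ w) (toℕ-fromℕ< i<n)
                        (bandwidth (fromℕ< i<n))
  ... | no _    = ≤-trans (≤-reflexive (∣n-n∣≡0 i)) z≤n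

  count-column : ∀ {Q : ℕ → Set} (Q? : Decidable Q) → count (Q? ∘ column) n ≡ count Q? n
  count-column Q? = begin
    count (Q? ∘ column) n                  ≡⟨ count≡sum (Q? ∘ column) n ⟩
    sum {n} (λ j → 𝟙 (Q? (column (toℕ j))))   ≡⟨ sum-cong-≗ (λ j → cong (λ i → 𝟙 (Q? i)) (column-toℕ j)) ⟩
    sum {n} (λ j → 𝟙 (Q? (toℕ (c P j))))      ≡⟨ sym (sum-permute (λ j → 𝟙 (Q? (toℕ j))) P) ⟩
    sum {n} (λ j → 𝟙 (Q? (toℕ j)))            ≡⟨ sym (count≡sum Q? n) ⟩
    count Q? n                             ∎
    where open ≡-Reasoning

theorem3p5 : (n : ℕ) (P : Permutation′ n) (w : ℕ) →
    ¬ IsIdentity P → Settled P → StrangCanonical P →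
    HasBandwidth P w → 1 ≤ w →
    Σ (List (Permutation′ n)) λ Qs →
      AllBandwidth≤1 Qs × length Qs < 2 * w × IsProductOf P Qs
theorem3p5 n P w _ _ _ (bandwidth , _) 1≤w =
  layers rounds , layers-bandwidth≤1 rounds , fewer-than-2w , product
  where
  open OddEvenSort n w 1≤w (column P) (column-< P) (column-injective P)
                   (column-bandwidth P bandwidth) (count-column P)
  fewer-than-2w : length (layers rounds) < 2 * w
  fewer-than-2w = subst (_< 2 * w) (sym (length-layers rounds))
    (m≤pred[n]⇒suc[m]≤n ⦃ >-nonZero (≤-trans 1≤w (m≤m+n w _)) ⦄ ≤-refl)
  product : IsProductOf P (layers rounds)
  product y = toℕ-injective (trans (sym (column-toℕ P y)) (sym (toℕ-productCol-layers y)))
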